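{- Let $X$ and $Y$ be simplicial complexes on ground set $[n]$, and let $\Psi=\{\Psi_1,\dots,\Psi_k\}\in\mathrm{Supp}_X(Y)$. Then $\Psi$ is the fundamental inflator $\mathrm{FInf}_X(Y)$ if and only if $Y=X|_{\Psi_1}*\cdots*X|_{\Psi_k}$ is the canonical join decomposition of $Y$ (i.e. $\Psi$ is the partition underlying the canonical join decomposition of $Y$).
   Context: A simplicial complex on $[n]$ is a family $X\subseteq2^{[n]}$ with $\emptyset\in X$, closed under taking subsets. For $S\subseteq[n]$, $X|_S=\{\sigma\in X:\sigma\subseteq S\}$; for a set partition $\Phi=\{\Phi_1,\dots,\Phi_k\}$ of $[n]$, $X_\Phi=X|_{\Phi_1}*\cdots*X|_{\Phi_k}=\{\sigma_1\cup\cdots\cup\sigma_k:\sigma_i\in X,\sigma_i\subseteq\Phi_i\}$. $\mathrm{Supp}_X(Y)=\{\Phi:X_\Phi=Y\}$. Partitions are ordered by reverse refinement; when $\mathrm{Supp}_X(Y)$ is nonempty it has a unique finest element, called the fundamental inflator $\mathrm{FInf}_X(Y)$. The canonical join decomposition of $Y$ is $Y=Y|_{\Phi_1}*\cdots*Y|_{\Phi_\ell}$ for the finest partition $\Phi$ of $[n]$ with $Y=Y_\Phi$ (the join decomposition with the maximum number of factors). -}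

module Defs where

open import Level using (Level; suc; _⊔_) renaming (zero to 0ℓ)
open import Data.Nat using (ℕ)
open import Data.Fin using (Fin)
open import Data.Fin.Subset using (Subset; _∈_; _⊆_; ⊥)
open import Data.Product using (Σ; ∃; ∃-syntax; _×_)
open import Relation.Binary.PropositionalEquality using (_≡_)
open import Function.Bundles using (_⇔_)

record Complex (n : ℕ) : Set₁ where
  field
    Face        : Subset n → Set
    empty-face  : Face ⊥
    down-closed : ∀ {σ τ} → τ ⊆ σ → Face σ → Face τ
open Complex public

_≈C_ : ∀ {n} → Complex n → Complex n → Set
X ≈C Y = ∀ σ → Face X σ ⇔ Face Y σ

-- A set partition of [n] given by a block labelling p : Fin n → Fin n;
-- the blocks are the nonempty fibres of p (every set partition of [n]
-- arises this way, since it has at most n blocks).  Labellings are only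
-- compared through the induced blocks (see _refines_).
Partition : ℕ → Set
Partition n = Fin n → Fin n

Block : ∀ {n} → Partition n → Fin n → Subset n → Set
Block Φ b σ = ∀ i → i ∈ σ → Φ i ≡ b

_refines_ : ∀ {n} → Partition n → Partition n → Set
Φ refines Ψ = ∀ i j → Φ i ≡ Φ j → Ψ i ≡ Ψ j

-- The join X_Φ = X|Φ₁ * ⋯ * X|Φ_k : faces are unions σ = ⋃_b σ_b with
-- σ_b ∈ X and σ_b ⊆ Φ_b (blocks indexed by labels b; empty label classes
-- contribute σ_b = ∅).
JoinFace : ∀ {n} → Complex n → Partition n → Subset n → Set
JoinFace X Φ σ =
  Σ (Fin _ → Subset _) λ fam →
    (∀ b → Face X (fam b) × Block Φ b (fam b)) ×
    (∀ i → (i ∈ σ) ⇔ (∃[ b ] (i ∈ fam b)))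

InSupp : ∀ {n} → Complex n → Complex n → Partition n → Set
InSupp X Y Φ = ∀ σ → JoinFace X Φ σ ⇔ Face Y σ

IsFinest : ∀ {n} → (Partition n → Set) → Partition n → Set
IsFinest P Φ = P Φ × (∀ Ψ → P Ψ → Φ refines Ψ)

IsFInf : ∀ {n} → Complex n → Complex n → Partition n → Set
IsFInf X Y Φ = IsFinest (InSupp X Y) Φ

IsCanonicalJoinPartition : ∀ {n} → Complex n → Partition n → Set
IsCanonicalJoinPartition Y Φ = IsFinest (InSupp Y Y) Φ

{-# OPTIONS --safe #-}
-- Faces of X_Φ are exactly the sets σ whose block parts σ ∩ Φ_b are faces of X.
-- Consequently X_Φ = Y implies Y_Φ = Y, so Supp_X(Y) ⊆ Supp_Y(Y); and if
-- X_Ψ = Y and Y_Φ = Y, then X_{Ψ ⊓ Φ} = Y, since a face of Y splits along Φ into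
-- faces of Y, each of which splits along Ψ into faces of X lying in single
-- cells of Ψ ⊓ Φ.  Thus the finest element Ψ of Supp_X(Y) refines Ψ ⊓ Φ, hence
-- every Φ in Supp_Y(Y); conversely, a Ψ ∈ Supp_X(Y) that is finest in
-- Supp_Y(Y) is finest in the smaller family Supp_X(Y).
module Submission where

open import Defs
open import Data.Nat using (ℕ)
open import Data.Bool.Properties using (T-≡)
open import Data.Empty using (⊥-elim)
open import Data.Fin using (Fin; _≟_)
open import Data.Fin.Properties using (any?)
open import Data.Fin.Subset using (Subset; _∈_; _⊆_; _∩_)
open import Data.Fin.Subset.Properties using (nonempty?; ⊆-refl; p∩q⊆p; x∈p∩q⁺; x∈p∩q⁻)
open import Data.Product using (∃; _×_; _,_; proj₁; proj₂)
open import Data.Vec using (tabulate)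
open import Data.Vec.Properties using ([]=⇒lookup; lookup⇒[]=; lookup∘tabulate)
open import Function.Bundles using (_⇔_; mk⇔; Equivalence)
open import Relation.Nullary using (yes; no)
open import Relation.Nullary.Decidable using (isYes; _×-dec_; toWitness; fromWitness)
open import Relation.Binary.PropositionalEquality using (_≡_; refl; sym; trans; cong; subst)

open Equivalence

private
  variable
    n : ℕ
    Φ Ψ : Partition n
    σ τ : Subset n

refines-trans : ∀ {Θ : Partition n} → Θ refines Ψ → Ψ refines Φ → Θ refines Φ
refines-trans Θ≤Ψ Ψ≤Φ i j e = Ψ≤Φ i j (Θ≤Ψ i j e)

fibre : Partition n → Fin n → Subset n
fibre Φ b = tabulate (λ i → isYes (Φ i ≟ b))

∈-fibre⁻ : ∀ {i b} → i ∈ fibre Φ b → Φ i ≡ b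
∈-fibre⁻ {Φ = Φ} {i} {b} i∈ =
  toWitness {a? = Φ i ≟ b}
    (from T-≡ (trans (sym (lookup∘tabulate (λ j → isYes (Φ j ≟ b)) i)) ([]=⇒lookup i∈)))

∈-fibre⁺ : ∀ {i b} → Φ i ≡ b → i ∈ fibre Φ b
∈-fibre⁺ {Φ = Φ} {i} {b} e =
  lookup⇒[]= i _
    (trans (lookup∘tabulate (λ j → isYes (Φ j ≟ b)) i) (to T-≡ (fromWitness {a? = Φ i ≟ b} e)))

InOneBlock : Partition n → Subset n → Set
InOneBlock Φ τ = ∀ {i j} → i ∈ τ → j ∈ τ → Φ i ≡ Φ j

∩-fibre-inOneBlock : ∀ b → InOneBlock Φ (σ ∩ fibre Φ b)
∩-fibre-inOneBlock {σ = σ} b i∈ j∈ =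
  trans (∈-fibre⁻ (proj₂ (x∈p∩q⁻ σ _ i∈))) (sym (∈-fibre⁻ (proj₂ (x∈p∩q⁻ σ _ j∈))))

joinFace⇒face : ∀ X Φ → JoinFace {n} X Φ σ → τ ⊆ σ → InOneBlock Φ τ → Face X τ
joinFace⇒face {τ = τ} X Φ (fam , components , cover) τ⊆σ oneBlock with nonempty? τ
... | no empty = down-closed X (λ i∈τ → ⊥-elim (empty (_ , i∈τ))) (empty-face X)
... | yes (j , j∈τ) = down-closed X τ⊆component (proj₁ (components (Φ j)))
  where
  τ⊆component : τ ⊆ fam (Φ j)
  τ⊆component {i} i∈τ with to (cover i) (τ⊆σ i∈τ)
  ... | b , i∈b = subst (λ c → i ∈ fam c) b≡Φj i∈b
    where
    b≡Φj : b ≡ Φ j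
    b≡Φj = trans (sym (proj₂ (components b) i i∈b)) (oneBlock i∈τ j∈τ)

blockwise⇒joinFace : ∀ X Φ → (∀ b → Face X (σ ∩ fibre Φ b)) → JoinFace X Φ σ
blockwise⇒joinFace {σ = σ} X Φ faces =
  (λ b → σ ∩ fibre Φ b) ,
  (λ b → faces b , λ i i∈ → ∈-fibre⁻ (proj₂ (x∈p∩q⁻ σ _ i∈))) ,
  λ i → mk⇔ (λ i∈σ → Φ i , x∈p∩q⁺ (i∈σ , ∈-fibre⁺ refl)) (λ (_ , i∈) → proj₁ (x∈p∩q⁻ σ _ i∈))

InSupp-self : ∀ X Y Φ → InSupp {n} X Y Φ → InSupp Y Y Φ
InSupp-self X Y Φ supp σ = mk⇔ joinY⇒Y Y⇒joinY
  where
  joinY⇒Y : JoinFace Y Φ σ → Face Y σ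
  joinY⇒Y joinY = to (supp σ) (blockwise⇒joinFace X Φ λ b →
    joinFace⇒face X Φ (from (supp _) (partY b)) ⊆-refl (∩-fibre-inOneBlock b))
    where
    partY : ∀ b → Face Y (σ ∩ fibre Φ b)
    partY b = joinFace⇒face Y Φ joinY (p∩q⊆p σ _) (∩-fibre-inOneBlock b)

  Y⇒joinY : Face Y σ → JoinFace Y Φ σ
  Y⇒joinY y = blockwise⇒joinFace Y Φ λ b → down-closed Y (p∩q⊆p σ _) y

-- The meet Ψ ⊓ Φ labels each element by a representative of its cell
-- (Ψ-block ∩ Φ-block), found by search.
module _ (Ψ Φ : Partition n) where
  private
    Cell : Fin n → Fin n → Fin n → Set
    Cell a b j = Ψ j ≡ a × Φ j ≡ b

    representative : ∀ {a b} → ∃ (Cell a b) → ∃ (Cell a b)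
    representative {a} {b} w with any? (λ j → (Ψ j ≟ a) ×-dec (Φ j ≟ b))
    ... | yes w′ = w′
    ... | no ∄ = ⊥-elim (∄ w)

    representative-cong : ∀ {a a′ b b′} → a ≡ a′ → b ≡ b′ →
      (w : ∃ (Cell a b)) (w′ : ∃ (Cell a′ b′)) → proj₁ (representative w) ≡ proj₁ (representative w′)
    representative-cong {a} {b = b} refl refl w w′ with any? (λ j → (Ψ j ≟ a) ×-dec (Φ j ≟ b))
    ... | yes _ = refl
    ... | no ∄ = ⊥-elim (∄ w)

  _⊓_ : Partition n
  _⊓_ i = proj₁ (representative (i , refl , refl))

  ⊓-cell : ∀ i → Ψ (_⊓_ i) ≡ Ψ i × Φ (_⊓_ i) ≡ Φ i
  ⊓-cell i = proj₂ (representative (i , refl , refl))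

  ⊓-cong : ∀ {i j} → Ψ i ≡ Ψ j → Φ i ≡ Φ j → _⊓_ i ≡ _⊓_ j
  ⊓-cong {i} {j} eΨ eΦ = representative-cong eΨ eΦ (i , refl , refl) (j , refl , refl)

  ⊓-refinesˡ : _⊓_ refines Ψ
  ⊓-refinesˡ i j e = trans (sym (proj₁ (⊓-cell i))) (trans (cong Ψ e) (proj₁ (⊓-cell j)))

  ⊓-refinesʳ : _⊓_ refines Φ
  ⊓-refinesʳ i j e = trans (sym (proj₂ (⊓-cell i))) (trans (cong Φ e) (proj₂ (⊓-cell j)))

InSupp-⊓ : ∀ X Y Ψ Φ → InSupp {n} X Y Ψ → InSupp Y Y Φ → InSupp X Y (Ψ ⊓ Φ)
InSupp-⊓ X Y Ψ Φ suppΨ suppΦ σ = mk⇔ joinFace⇒Y Y⇒joinFace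
  where
  cellInOneBlock : ∀ a b → InOneBlock (Ψ ⊓ Φ) ((σ ∩ fibre Φ b) ∩ fibre Ψ a)
  cellInOneBlock a b i∈ j∈ = ⊓-cong Ψ Φ
    (∩-fibre-inOneBlock a i∈ j∈)
    (∩-fibre-inOneBlock b (proj₁ (x∈p∩q⁻ _ _ i∈)) (proj₁ (x∈p∩q⁻ _ _ j∈)))

  joinFace⇒Y : JoinFace X (Ψ ⊓ Φ) σ → Face Y σ
  joinFace⇒Y join = to (suppΦ σ) (blockwise⇒joinFace Y Φ λ b →
    to (suppΨ _) (blockwise⇒joinFace X Ψ λ a →
      joinFace⇒face X (Ψ ⊓ Φ) join (λ i∈ → p∩q⊆p σ _ (p∩q⊆p _ _ i∈)) (cellInOneBlock a b)))

  Y⇒joinFace : Face Y σ → JoinFace X (Ψ ⊓ Φ) σ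
  Y⇒joinFace y = blockwise⇒joinFace X (Ψ ⊓ Φ) λ c →
    joinFace⇒face X Ψ (from (suppΨ σ) y) (p∩q⊆p σ _) λ i∈ j∈ →
      ⊓-refinesˡ Ψ Φ _ _ (∩-fibre-inOneBlock c i∈ j∈)

proposition5p6 : ∀ (n : ℕ) (X Y : Complex n) (Ψ : Partition n) →
    InSupp X Y Ψ →
    (IsFInf X Y Ψ ⇔ IsCanonicalJoinPartition Y Ψ)
proposition5p6 n X Y Ψ suppΨ = mk⇔
  (λ (_ , finest) → InSupp-self X Y Ψ suppΨ , λ Φ suppΦ →
    refines-trans (finest (Ψ ⊓ Φ) (InSupp-⊓ X Y Ψ Φ suppΨ suppΦ)) (⊓-refinesʳ Ψ Φ))
  (λ (_ , finest) → suppΨ , λ Φ suppΦ → finest Φ (InSupp-self X Y Φ suppΦ))
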